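{- For all positive integers $k,n$, we have $T_L(n)\geq 3^k$ if and only if $b'_3(k,2)\leq n$.
   Context: $T_L(n)$ denotes the maximum size of a linear trifferent code of length $n$, i.e., of a linear subspace $C\subseteq\mathbb{F}_3^n$ such that for any three distinct $x,y,z\in C$ there is a coordinate $i$ with $\{x_i,y_i,z_i\}=\mathbb{F}_3$. $b'_3(k,2)$ denotes the minimum size of a subset $B\subseteq\mathbb{F}_3^k$ such that $\bigcup_{\zeta\in\mathbb{F}_3}\zeta B=\{\vec 0\}\cup B\cup -B$ is a $2$-blocking set in $\mathbb{F}_3^k$, where a $2$-blocking set is a set of points meeting every affine subspace of codimension $2$ of $\mathbb{F}_3^k$. -}

module Defs where

open import Data.Nat using (ℕ; _≤_; _^_)
open import Data.Fin using (Fin; zero; suc)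
open import Data.Vec using (Vec; lookup; replicate; zipWith; map)
open import Data.List using (List; length)
open import Data.List.Membership.Propositional using (_∈_)
open import Data.List.Relation.Unary.Unique.Propositional using (Unique)
open import Data.Product using (Σ; ∃; _×_; _,_)
open import Data.Sum using (_⊎_)
open import Relation.Binary.PropositionalEquality using (_≡_; _≢_)

F₃ : Set
F₃ = Fin 3

_+₃_ : F₃ → F₃ → F₃
zero +₃ b = b
suc zero +₃ zero = suc zero
suc zero +₃ suc zero = suc (suc zero)
suc zero +₃ suc (suc zero) = zero
suc (suc zero) +₃ zero = suc (suc zero)
suc (suc zero) +₃ suc zero = zero
suc (suc zero) +₃ suc (suc zero) = suc zero

_*₃_ : F₃ → F₃ → F₃
zero *₃ b = zero
suc zero *₃ b = b
suc (suc zero) *₃ zero = zero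
suc (suc zero) *₃ suc zero = suc (suc zero)
suc (suc zero) *₃ suc (suc zero) = suc zero

-₃_ : F₃ → F₃
-₃ a = suc (suc zero) *₃ a

𝔽 : ℕ → Set
𝔽 n = Vec F₃ n

𝟎 : ∀ {n} → 𝔽 n
𝟎 = replicate _ zero

_⊕_ : ∀ {n} → 𝔽 n → 𝔽 n → 𝔽 n
_⊕_ = zipWith _+₃_

_·_ : ∀ {n} → F₃ → 𝔽 n → 𝔽 n
ζ · v = map (ζ *₃_) v

dot : ∀ {n} → 𝔽 n → 𝔽 n → F₃
dot {ℕ.zero} _ _ = zero
dot {ℕ.suc n} (a Vec.∷ as) (b Vec.∷ bs) = (a *₃ b) +₃ dot as bs

-- Finite subsets of F₃ⁿ are duplicate-free lists; their size is the length.

IsLinear : ∀ {n} → List (𝔽 n) → Set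
IsLinear C = (𝟎 ∈ C)
           × (∀ {x y} → x ∈ C → y ∈ C → (x ⊕ y) ∈ C)
           × (∀ ζ {x} → x ∈ C → (ζ · x) ∈ C)

IsTrifferent : ∀ {n} → List (𝔽 n) → Set
IsTrifferent {n} C =
  ∀ {x y z} → x ∈ C → y ∈ C → z ∈ C → x ≢ y → y ≢ z → x ≢ z →
  ∃ λ (i : Fin n) → ∀ (a : F₃) →
    (a ≡ lookup x i) ⊎ (a ≡ lookup y i) ⊎ (a ≡ lookup z i)

-- "T_L(n) ≥ m": some linear trifferent code of length n has at least m words
-- (T_L(n) is the maximum of these sizes, over a finite nonempty family).
T_L-≥ : ℕ → ℕ → Set
T_L-≥ n m = Σ (List (𝔽 n)) λ C → Unique C × IsLinear C × IsTrifferent C × m ≤ length C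

-- Affine subspaces of codimension 2 of F₃ᵏ: solution sets
-- {x | a₁·x = c₁, a₂·x = c₂} with a₁, a₂ linearly independent.
LinIndep₂ : ∀ {k} → 𝔽 k → 𝔽 k → Set
LinIndep₂ a₁ a₂ = ∀ λ₁ λ₂ → ((λ₁ · a₁) ⊕ (λ₂ · a₂)) ≡ 𝟎 → (λ₁ ≡ zero) × (λ₂ ≡ zero)

-- S (given as a predicate) is a 2-blocking set: it meets every affine
-- subspace of codimension 2.
Is2Blocking : ∀ {k} → (𝔽 k → Set) → Set
Is2Blocking {k} S =
  ∀ (a₁ a₂ : 𝔽 k) (c₁ c₂ : F₃) → LinIndep₂ a₁ a₂ →
  ∃ λ (v : 𝔽 k) → S v × dot a₁ v ≡ c₁ × dot a₂ v ≡ c₂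

Scaled : ∀ {k} → List (𝔽 k) → 𝔽 k → Set
Scaled B v = ∃ λ (ζ : F₃) → ∃ λ b → b ∈ B × v ≡ ζ · b

-- "b'₃(k,2) ≤ n": some B ⊆ F₃ᵏ with |B| ≤ n has ⋃ ζB 2-blocking
-- (b'₃(k,2) is the minimum of these sizes).
b'₃-≤ : ℕ → ℕ → Set
b'₃-≤ k n = Σ (List (𝔽 k)) λ B → Unique B × Is2Blocking (Scaled B) × length B ≤ n

{-# OPTIONS --safe #-}
-- A linear code of dimension k and length n is the image of x ↦ (x·g₁, …, x·gₙ) for columns
-- g₁, …, gₙ ∈ F₃ᵏ. By linearity it is trifferent iff for all distinct nonzero p, q the words
-- 0, p·g, q·g take all three values at some coordinate. For dependent p, q (over F₃: q = -p)
-- any coordinate with p·gᵢ ≠ 0 does; for independent p, q the condition is that some ζgᵢ lies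
-- in the affine subspace {v | p·v = 1, q·v = 2}. An invertible change of (p, q) moves any
-- {v | p·v = c₁, q·v = c₂} with (c₁, c₂) ≠ 0 to this form, so trifferency says exactly that
-- ⋃ ζ{g₁, …, gₙ} is 2-blocking. Conversely a blocking set B, padded with zero columns, is such a
-- set of columns; for k ≥ 2 every nonzero p belongs to an independent pair, so the columns span
-- and the code has 3ᵏ words. A linear code with at least 3ᵏ words contains a k-dimensional
-- subcode, found greedily. For k = 1 there are no independent pairs and a repetition code works.

module Submission where

open import Defs
open import Data.Nat using (ℕ; _≤_; _^_; _<_; _+_; _*_; z≤n; s≤s)
open import Function.Bundles using (_⇔_; mk⇔)
import Data.Nat as ℕ
import Data.Nat.Properties as ℕₚ
open import Data.Fin using (Fin; zero; suc)
open import Data.Fin.Properties using (_≟_; all?; any?)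
open import Data.Vec using (Vec; []; _∷_; lookup; replicate; zipWith; map; padRight; fromList)
import Data.Vec.Properties as Vecₚ
open import Data.List as List using (List; length; cartesianProductWith; allFin; deduplicate; tabulate)
import Data.List.Properties as Listₚ
open import Data.List.Membership.Propositional using (_∈_; _∉_; find; lose)
open import Data.List.Membership.Propositional.Properties
  using (∈-map⁺; ∈-map⁻; ∈-allFin; ∈-tabulate⁺; ∈-deduplicate⁺; ∈-filter⁺)
import Data.List.Membership.DecPropositional as DecMembership
open import Data.List.Relation.Unary.Any as Any using (here; there)
import Data.List.Relation.Unary.Any.Properties as Anyₚ
import Data.List.Relation.Unary.All as All
open import Data.List.Relation.Unary.Unique.Propositional using (Unique)
import Data.List.Relation.Unary.Unique.Propositional.Properties as Uniqueₚ
import Data.List.Relation.Unary.Unique.DecPropositional.Properties as UniqueDecₚ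
import Data.List.Relation.Unary.AllPairs as AllPairs
open import Data.List.Relation.Binary.Subset.Propositional using (_⊆_)
open import Data.Product using (Σ; ∃; ∃₂; _×_; _,_; proj₁; proj₂)
open import Data.Sum using (_⊎_; inj₁; inj₂)
open import Data.Empty using (⊥-elim)
open import Function.Definitions using (Injective)
open import Relation.Nullary using (¬_; Dec; yes; no)
open import Relation.Nullary.Decidable using (from-yes; decidable-stable; ¬?; _×-dec_; _⊎-dec_; _→-dec_)
open import Relation.Binary.Definitions using (DecidableEquality)
open import Relation.Binary.PropositionalEquality

pattern 𝟙 = suc zero
pattern 𝟚 = suc (suc zero)

_−₃_ : F₃ → F₃ → F₃
a −₃ b = a +₃ (-₃ b)

+₃-identityʳ : ∀ a → a +₃ zero ≡ a
+₃-identityʳ = from-yes (all? λ a → a +₃ zero ≟ a)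

*₃-identityʳ : ∀ a → a *₃ 𝟙 ≡ a
*₃-identityʳ = from-yes (all? λ a → a *₃ 𝟙 ≟ a)

*₃-zeroʳ : ∀ a → a *₃ zero ≡ zero
*₃-zeroʳ = from-yes (all? λ a → a *₃ zero ≟ zero)

+₃-interchange : ∀ a b c d → (a +₃ b) +₃ (c +₃ d) ≡ (a +₃ c) +₃ (b +₃ d)
+₃-interchange = from-yes (all? λ a → all? λ b → all? λ c → all? λ d →
  (a +₃ b) +₃ (c +₃ d) ≟ (a +₃ c) +₃ (b +₃ d))

*₃-assoc : ∀ a b c → (a *₃ b) *₃ c ≡ a *₃ (b *₃ c)
*₃-assoc = from-yes (all? λ a → all? λ b → all? λ c → (a *₃ b) *₃ c ≟ a *₃ (b *₃ c))

*₃-comm : ∀ a b → a *₃ b ≡ b *₃ a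
*₃-comm = from-yes (all? λ a → all? λ b → a *₃ b ≟ b *₃ a)

*₃-distribˡ-+₃ : ∀ a b c → a *₃ (b +₃ c) ≡ (a *₃ b) +₃ (a *₃ c)
*₃-distribˡ-+₃ = from-yes (all? λ a → all? λ b → all? λ c → a *₃ (b +₃ c) ≟ (a *₃ b) +₃ (a *₃ c))

*₃-distribʳ-+₃ : ∀ a b c → (b +₃ c) *₃ a ≡ (b *₃ a) +₃ (c *₃ a)
*₃-distribʳ-+₃ = from-yes (all? λ a → all? λ b → all? λ c → (b +₃ c) *₃ a ≟ (b *₃ a) +₃ (c *₃ a))

−₃-self : ∀ a → a −₃ a ≡ zero
−₃-self = from-yes (all? λ a → a −₃ a ≟ zero)

−₃-≡zero⇒≡ : ∀ {a b} → a −₃ b ≡ zero → a ≡ b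
−₃-≡zero⇒≡ {a} {b} = from-yes (all? λ a → all? λ b → (a −₃ b ≟ zero) →-dec (a ≟ b)) a b

−₃-cancelʳ : ∀ {a b c} → b −₃ a ≡ c −₃ a → b ≡ c
−₃-cancelʳ {a} {b} {c} = from-yes (all? λ a → all? λ b → all? λ c →
  (b −₃ a ≟ c −₃ a) →-dec (b ≟ c)) a b c

*₃-+₃-solve : ∀ {a c u} → a ≢ zero → (a *₃ c) +₃ u ≡ zero → c ≡ (-₃ a) *₃ u
*₃-+₃-solve {a} {c} {u} = from-yes (all? λ a → all? λ c → all? λ u →
  ¬? (a ≟ zero) →-dec (((a *₃ c) +₃ u ≟ zero) →-dec (c ≟ (-₃ a) *₃ u))) a c u

nonzero-coefficient : ∀ λ₁ λ₂ {a} → a ≢ zero → (λ₁ *₃ a) +₃ (λ₂ *₃ zero) ≡ zero → λ₁ ≡ zero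
nonzero-coefficient λ₁ λ₂ {a} = from-yes (all? λ λ₁ → all? λ λ₂ → all? λ a →
  ¬? (a ≟ zero) →-dec (((λ₁ *₃ a) +₃ (λ₂ *₃ zero) ≟ zero) →-dec (λ₁ ≟ zero))) λ₁ λ₂ a

unit-coefficient : ∀ λ₁ λ₂ a → (λ₁ *₃ a) +₃ (λ₂ *₃ 𝟙) ≡ zero → λ₁ *₃ a ≡ zero → λ₂ ≡ zero
unit-coefficient λ₁ λ₂ a = from-yes (all? λ λ₁ → all? λ λ₂ → all? λ a →
  ((λ₁ *₃ a) +₃ (λ₂ *₃ 𝟙) ≟ zero) →-dec ((λ₁ *₃ a ≟ zero) →-dec (λ₂ ≟ zero))) λ₁ λ₂ a

Covers : F₃ → F₃ → F₃ → Set
Covers a b c = ∀ e → e ≡ a ⊎ e ≡ b ⊎ e ≡ c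

covers? : ∀ a b c → Dec (Covers a b c)
covers? a b c = all? λ e → (e ≟ a) ⊎-dec (e ≟ b) ⊎-dec (e ≟ c)

covers⇒scaled-𝟙𝟚 : ∀ {P Q} → Covers zero P Q → ∃ λ ζ → ζ *₃ P ≡ 𝟙 × ζ *₃ Q ≡ 𝟚
covers⇒scaled-𝟙𝟚 {P} {Q} = from-yes (all? λ P → all? λ Q →
  covers? zero P Q →-dec any? λ ζ → (ζ *₃ P ≟ 𝟙) ×-dec (ζ *₃ Q ≟ 𝟚)) P Q

scaled-𝟙𝟚⇒covers : ∀ ζ {P Q} → ζ *₃ P ≡ 𝟙 → ζ *₃ Q ≡ 𝟚 → Covers zero P Q
scaled-𝟙𝟚⇒covers ζ {P} {Q} = from-yes (all? λ ζ → all? λ P → all? λ Q →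
  (ζ *₃ P ≟ 𝟙) →-dec ((ζ *₃ Q ≟ 𝟚) →-dec covers? zero P Q)) ζ P Q

covers-double : ∀ {P} → P ≢ zero → Covers zero P (𝟚 *₃ P)
covers-double {P} = from-yes (all? λ P → ¬? (P ≟ zero) →-dec covers? zero P (𝟚 *₃ P)) P

covers-cong : ∀ {a b c a′ b′ c′} → a ≡ a′ → b ≡ b′ → c ≡ c′ → Covers a b c → Covers a′ b′ c′
covers-cong refl refl refl covers = covers

covers-translate : ∀ {A B C} → Covers zero (B −₃ A) (C −₃ A) → Covers A B C
covers-translate {A} {B} {C} = from-yes (all? λ A → all? λ B → all? λ C →
  covers? zero (B −₃ A) (C −₃ A) →-dec covers? A B C) A B C

_≟ᵥ_ : ∀ {n} → DecidableEquality (𝔽 n)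
_≟ᵥ_ = Vecₚ.≡-dec _≟_

_⊖_ : ∀ {n} → 𝔽 n → 𝔽 n → 𝔽 n
x ⊖ y = x ⊕ (𝟚 · y)

combine : ∀ {n} → F₃ → F₃ → 𝔽 n → 𝔽 n → 𝔽 n
combine λ₁ λ₂ u v = (λ₁ · u) ⊕ (λ₂ · v)

lookup-ext : ∀ {n} {u v : 𝔽 n} → (∀ i → lookup u i ≡ lookup v i) → u ≡ v
lookup-ext {u = u} {v} h =
  trans (sym (Vecₚ.tabulate∘lookup u)) (trans (Vecₚ.tabulate-cong h) (Vecₚ.tabulate∘lookup v))

lookup-𝟎 : ∀ {n} (i : Fin n) → lookup 𝟎 i ≡ zero
lookup-𝟎 i = Vecₚ.lookup-replicate i zero

lookup-combine : ∀ {n} λ₁ λ₂ (u v : 𝔽 n) i →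
                 lookup (combine λ₁ λ₂ u v) i ≡ (λ₁ *₃ lookup u i) +₃ (λ₂ *₃ lookup v i)
lookup-combine λ₁ λ₂ u v i = trans (Vecₚ.lookup-zipWith _+₃_ i (λ₁ · u) (λ₂ · v))
                                   (cong₂ _+₃_ (Vecₚ.lookup-map i _ u) (Vecₚ.lookup-map i _ v))

combine-≡𝟎⇒pointwise : ∀ {n λ₁ λ₂} {u v : 𝔽 n} → combine λ₁ λ₂ u v ≡ 𝟎 →
                       ∀ i → (λ₁ *₃ lookup u i) +₃ (λ₂ *₃ lookup v i) ≡ zero
combine-≡𝟎⇒pointwise {λ₁ = λ₁} {λ₂} {u} {v} eq i =
  trans (sym (lookup-combine λ₁ λ₂ u v i)) (trans (cong (λ w → lookup w i) eq) (lookup-𝟎 i))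

pointwise⇒combine-≡𝟎 : ∀ {n} λ₁ λ₂ {u v : 𝔽 n} →
                       (∀ i → (λ₁ *₃ lookup u i) +₃ (λ₂ *₃ lookup v i) ≡ zero) → combine λ₁ λ₂ u v ≡ 𝟎
pointwise⇒combine-≡𝟎 λ₁ λ₂ {u} {v} h =
  lookup-ext λ i → trans (lookup-combine λ₁ λ₂ u v i) (trans (h i) (sym (lookup-𝟎 i)))

⊖-self : ∀ {n} (v : 𝔽 n) → v ⊖ v ≡ 𝟎
⊖-self []      = refl
⊖-self (a ∷ v) = cong₂ _∷_ (−₃-self a) (⊖-self v)

⊖-≡𝟎⇒≡ : ∀ {n} {x y : 𝔽 n} → x ⊖ y ≡ 𝟎 → x ≡ y
⊖-≡𝟎⇒≡ {x = []}    {[]}    _  = refl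
⊖-≡𝟎⇒≡ {x = a ∷ x} {b ∷ y} eq =
  cong₂ _∷_ (−₃-≡zero⇒≡ {a} {b} (Vecₚ.∷-injectiveˡ eq)) (⊖-≡𝟎⇒≡ (Vecₚ.∷-injectiveʳ eq))

⊖-cancelʳ : ∀ {n} {x y z : 𝔽 n} → y ⊖ x ≡ z ⊖ x → y ≡ z
⊖-cancelʳ {x = []}    {[]}    {[]}    _  = refl
⊖-cancelʳ {x = a ∷ x} {b ∷ y} {c ∷ z} eq =
  cong₂ _∷_ (−₃-cancelʳ {a} {b} {c} (Vecₚ.∷-injectiveˡ eq)) (⊖-cancelʳ (Vecₚ.∷-injectiveʳ eq))

zero·-⊕ : ∀ {n} (c u : 𝔽 n) → (zero · c) ⊕ u ≡ u
zero·-⊕ []      []      = refl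
zero·-⊕ (_ ∷ c) (a ∷ u) = cong (a ∷_) (zero·-⊕ c u)

·-⊕-solve : ∀ {n a} {c u : 𝔽 n} → a ≢ zero → (a · c) ⊕ u ≡ 𝟎 → c ≡ (-₃ a) · u
·-⊕-solve {c = []}    {[]}    _   _  = refl
·-⊕-solve {c = b ∷ c} {v ∷ u} a≢0 eq =
  cong₂ _∷_ (*₃-+₃-solve {c = b} {v} a≢0 (Vecₚ.∷-injectiveˡ eq)) (·-⊕-solve a≢0 (Vecₚ.∷-injectiveʳ eq))

combine-combine : ∀ {n} λ₁ λ₂ μ₁ μ₂ ν₁ ν₂ (a₁ a₂ : 𝔽 n) →
  combine λ₁ λ₂ (combine μ₁ μ₂ a₁ a₂) (combine ν₁ ν₂ a₁ a₂)
    ≡ combine ((λ₁ *₃ μ₁) +₃ (λ₂ *₃ ν₁)) ((λ₁ *₃ μ₂) +₃ (λ₂ *₃ ν₂)) a₁ a₂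
combine-combine λ₁ λ₂ μ₁ μ₂ ν₁ ν₂ []       []       = refl
combine-combine λ₁ λ₂ μ₁ μ₂ ν₁ ν₂ (a ∷ a₁) (b ∷ a₂) =
  cong₂ _∷_ (entry λ₁ λ₂ μ₁ μ₂ ν₁ ν₂ a b) (combine-combine λ₁ λ₂ μ₁ μ₂ ν₁ ν₂ a₁ a₂)
  where
  entry : ∀ λ₁ λ₂ μ₁ μ₂ ν₁ ν₂ a b →
    (λ₁ *₃ ((μ₁ *₃ a) +₃ (μ₂ *₃ b))) +₃ (λ₂ *₃ ((ν₁ *₃ a) +₃ (ν₂ *₃ b)))
      ≡ (((λ₁ *₃ μ₁) +₃ (λ₂ *₃ ν₁)) *₃ a) +₃ (((λ₁ *₃ μ₂) +₃ (λ₂ *₃ ν₂)) *₃ b)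
  entry = from-yes (all? λ λ₁ → all? λ λ₂ → all? λ μ₁ → all? λ μ₂ → all? λ ν₁ → all? λ ν₂ →
    all? λ a → all? λ b →
    (λ₁ *₃ ((μ₁ *₃ a) +₃ (μ₂ *₃ b))) +₃ (λ₂ *₃ ((ν₁ *₃ a) +₃ (ν₂ *₃ b)))
      ≟ (((λ₁ *₃ μ₁) +₃ (λ₂ *₃ ν₁)) *₃ a) +₃ (((λ₁ *₃ μ₂) +₃ (λ₂ *₃ ν₂)) *₃ b))

dot-𝟎ˡ : ∀ {n} (v : 𝔽 n) → dot 𝟎 v ≡ zero
dot-𝟎ˡ []      = refl
dot-𝟎ˡ (_ ∷ v) = dot-𝟎ˡ v

dot-⊕ˡ : ∀ {n} (x y v : 𝔽 n) → dot (x ⊕ y) v ≡ dot x v +₃ dot y v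
dot-⊕ˡ []      []      []      = refl
dot-⊕ˡ (a ∷ x) (c ∷ y) (b ∷ v) = begin
  ((a +₃ c) *₃ b) +₃ dot (x ⊕ y) v               ≡⟨ cong₂ _+₃_ (*₃-distribʳ-+₃ b a c) (dot-⊕ˡ x y v) ⟩
  ((a *₃ b) +₃ (c *₃ b)) +₃ (dot x v +₃ dot y v) ≡⟨ +₃-interchange (a *₃ b) (c *₃ b) (dot x v) (dot y v) ⟩
  ((a *₃ b) +₃ dot x v) +₃ ((c *₃ b) +₃ dot y v) ∎
  where open ≡-Reasoning

dot-·ˡ : ∀ {n} ζ (x v : 𝔽 n) → dot (ζ · x) v ≡ ζ *₃ dot x v
dot-·ˡ ζ []      []      = sym (*₃-zeroʳ ζ)
dot-·ˡ ζ (a ∷ x) (b ∷ v) = begin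
  ((ζ *₃ a) *₃ b) +₃ dot (ζ · x) v     ≡⟨ cong₂ _+₃_ (*₃-assoc ζ a b) (dot-·ˡ ζ x v) ⟩
  (ζ *₃ (a *₃ b)) +₃ (ζ *₃ dot x v)    ≡⟨ *₃-distribˡ-+₃ ζ _ _ ⟨
  ζ *₃ ((a *₃ b) +₃ dot x v)           ∎
  where open ≡-Reasoning

dot-·ʳ : ∀ {n} ζ (x v : 𝔽 n) → dot x (ζ · v) ≡ ζ *₃ dot x v
dot-·ʳ ζ []      []      = sym (*₃-zeroʳ ζ)
dot-·ʳ ζ (a ∷ x) (b ∷ v) = begin
  (a *₃ (ζ *₃ b)) +₃ dot x (ζ · v)     ≡⟨ cong₂ _+₃_ (sym (*₃-assoc a ζ b)) (dot-·ʳ ζ x v) ⟩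
  ((a *₃ ζ) *₃ b) +₃ (ζ *₃ dot x v)    ≡⟨ cong (λ c → (c *₃ b) +₃ (ζ *₃ dot x v)) (*₃-comm a ζ) ⟩
  ((ζ *₃ a) *₃ b) +₃ (ζ *₃ dot x v)    ≡⟨ cong (_+₃ (ζ *₃ dot x v)) (*₃-assoc ζ a b) ⟩
  (ζ *₃ (a *₃ b)) +₃ (ζ *₃ dot x v)    ≡⟨ *₃-distribˡ-+₃ ζ _ _ ⟨
  ζ *₃ ((a *₃ b) +₃ dot x v)           ∎
  where open ≡-Reasoning

dot-combine : ∀ {n} μ₁ μ₂ (a₁ a₂ v : 𝔽 n) →
              dot (combine μ₁ μ₂ a₁ a₂) v ≡ (μ₁ *₃ dot a₁ v) +₃ (μ₂ *₃ dot a₂ v)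
dot-combine μ₁ μ₂ a₁ a₂ v =
  trans (dot-⊕ˡ (μ₁ · a₁) (μ₂ · a₂) v) (cong₂ _+₃_ (dot-·ˡ μ₁ a₁ v) (dot-·ˡ μ₂ a₂ v))

dot-⊖ˡ : ∀ {n} (x y v : 𝔽 n) → dot (x ⊖ y) v ≡ dot x v −₃ dot y v
dot-⊖ˡ x y v = trans (dot-⊕ˡ x (𝟚 · y) v) (cong (dot x v +₃_) (dot-·ˡ 𝟚 y v))

LinIndep₂⇒distinct : ∀ {n} {p q : 𝔽 n} → LinIndep₂ p q → p ≢ 𝟎 × q ≢ 𝟎 × p ≢ q
LinIndep₂⇒distinct {p = p} {q} ind = p≢𝟎 , q≢𝟎 , p≢q
  where
  p≢𝟎 : p ≢ 𝟎
  p≢𝟎 p≡𝟎 with ind 𝟙 zero (pointwise⇒combine-≡𝟎 𝟙 zero λ i →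
                   cong (_+₃ zero) (trans (cong (λ w → lookup w i) p≡𝟎) (lookup-𝟎 i)))
  ... | () , _
  q≢𝟎 : q ≢ 𝟎
  q≢𝟎 q≡𝟎 with ind zero 𝟙 (pointwise⇒combine-≡𝟎 zero 𝟙 λ i →
                   trans (cong (λ w → lookup w i) q≡𝟎) (lookup-𝟎 i))
  ... | _ , ()
  p≢q : p ≢ q
  p≢q p≡q with ind 𝟙 𝟚 (pointwise⇒combine-≡𝟎 𝟙 𝟚 λ i →
                 trans (cong (λ w → lookup w i −₃ lookup q i) p≡q) (−₃-self (lookup q i)))
  ... | () , _

distinct⇒LinIndep₂⊎double : ∀ {n} {p q : 𝔽 n} → p ≢ 𝟎 → q ≢ 𝟎 → p ≢ q → LinIndep₂ p q ⊎ q ≡ 𝟚 · p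
distinct⇒LinIndep₂⊎double {p = p} {q} p≢𝟎 q≢𝟎 p≢q with q ≟ᵥ (𝟚 · p)
... | yes q≡2p = inj₂ q≡2p
... | no  q≢2p = inj₁ ind
  where
  Forces : F₃ → F₃ → (F₃ → F₃ → Set) → Set
  Forces λ₁ λ₂ R = ∀ a b → (λ₁ *₃ a) +₃ (λ₂ *₃ b) ≡ zero → R a b
  forces? : ∀ λ₁ λ₂ R → (∀ a b → Dec (R a b)) → Dec (Forces λ₁ λ₂ R)
  forces? λ₁ λ₂ R R? = all? λ a → all? λ b → ((λ₁ *₃ a) +₃ (λ₂ *₃ b) ≟ zero) →-dec R? a b
  dependencies : ∀ λ₁ λ₂ → (λ₁ ≡ zero × λ₂ ≡ zero) ⊎ Forces λ₁ λ₂ (λ a _ → a ≡ zero)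
    ⊎ Forces λ₁ λ₂ (λ _ b → b ≡ zero) ⊎ Forces λ₁ λ₂ _≡_ ⊎ Forces λ₁ λ₂ (λ a b → b ≡ 𝟚 *₃ a)
  dependencies = from-yes (all? λ λ₁ → all? λ λ₂ → ((λ₁ ≟ zero) ×-dec (λ₂ ≟ zero))
    ⊎-dec forces? λ₁ λ₂ _ (λ a _ → a ≟ zero) ⊎-dec forces? λ₁ λ₂ _ (λ _ b → b ≟ zero)
    ⊎-dec forces? λ₁ λ₂ _ _≟_ ⊎-dec forces? λ₁ λ₂ _ (λ a b → b ≟ 𝟚 *₃ a))
  ind : LinIndep₂ p q
  ind λ₁ λ₂ eq with dependencies λ₁ λ₂ | combine-≡𝟎⇒pointwise eq
  ... | inj₁ zeros                  | _  = zeros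
  ... | inj₂ (inj₁ f)               | pt = ⊥-elim (p≢𝟎 (lookup-ext λ i → trans (f _ _ (pt i)) (sym (lookup-𝟎 i))))
  ... | inj₂ (inj₂ (inj₁ f))        | pt = ⊥-elim (q≢𝟎 (lookup-ext λ i → trans (f _ _ (pt i)) (sym (lookup-𝟎 i))))
  ... | inj₂ (inj₂ (inj₂ (inj₁ f))) | pt = ⊥-elim (p≢q (lookup-ext λ i → f _ _ (pt i)))
  ... | inj₂ (inj₂ (inj₂ (inj₂ f))) | pt =
    ⊥-elim (q≢2p (lookup-ext λ i → trans (f _ _ (pt i)) (sym (Vecₚ.lookup-map i (𝟚 *₃_) p))))

LinIndep₂-combine : ∀ {n μ₁ μ₂ ν₁ ν₂} {a₁ a₂ : 𝔽 n} → LinIndep₂ a₁ a₂ →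
                    LinIndep₂ (μ₁ ∷ μ₂ ∷ []) (ν₁ ∷ ν₂ ∷ []) →
                    LinIndep₂ (combine μ₁ μ₂ a₁ a₂) (combine ν₁ ν₂ a₁ a₂)
LinIndep₂-combine {μ₁ = μ₁} {μ₂} {ν₁} {ν₂} {a₁} {a₂} ind coefficients λ₁ λ₂ eq =
  coefficients λ₁ λ₂ (cong₂ _∷_ (proj₁ κ≡0) (cong (_∷ []) (proj₂ κ≡0)))
  where
  κ≡0 = ind _ _ (trans (sym (combine-combine λ₁ λ₂ μ₁ μ₂ ν₁ ν₂ a₁ a₂)) eq)

-- The rows (c₁, c₂) and (companion₁ c₁ c₂, companion₂ c₁ c₂) form an invertible matrix M with
-- M (c₁, c₂)ᵀ = s (1, 2)ᵀ, where s = c₁² + c₂² is nonzero since -1 is not a square in F₃.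
companion₁ companion₂ : F₃ → F₃ → F₃
companion₁ c₁ c₂ = c₂ −₃ c₁
companion₂ c₁ c₂ = -₃ (c₁ +₃ c₂)

companion-pullback : ∀ ζ {c₁ c₂ X Y} → ζ *₃ ((c₁ *₃ X) +₃ (c₂ *₃ Y)) ≡ 𝟙 →
                     ζ *₃ ((companion₁ c₁ c₂ *₃ X) +₃ (companion₂ c₁ c₂ *₃ Y)) ≡ 𝟚 →
                     ∃ λ ζ′ → ζ′ *₃ X ≡ c₁ × ζ′ *₃ Y ≡ c₂
companion-pullback ζ {c₁} {c₂} {X} {Y} = from-yes (all? λ ζ → all? λ c₁ → all? λ c₂ → all? λ X → all? λ Y →
  (ζ *₃ ((c₁ *₃ X) +₃ (c₂ *₃ Y)) ≟ 𝟙) →-dec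
  ((ζ *₃ ((companion₁ c₁ c₂ *₃ X) +₃ (companion₂ c₁ c₂ *₃ Y)) ≟ 𝟚) →-dec
  any? λ ζ′ → (ζ′ *₃ X ≟ c₁) ×-dec (ζ′ *₃ Y ≟ c₂))) ζ c₁ c₂ X Y

companion-LinIndep₂ : ∀ {c₁ c₂} → (c₁ ∷ c₂ ∷ []) ≢ 𝟎 →
                      LinIndep₂ (c₁ ∷ c₂ ∷ []) (companion₁ c₁ c₂ ∷ companion₂ c₁ c₂ ∷ [])
companion-LinIndep₂ {c₁} {c₂} = from-yes (all? λ c₁ → all? λ c₂ → ¬? ((c₁ ∷ c₂ ∷ []) ≟ᵥ 𝟎) →-dec
  all? λ λ₁ → all? λ λ₂ → (combine λ₁ λ₂ (c₁ ∷ c₂ ∷ []) (companion₁ c₁ c₂ ∷ companion₂ c₁ c₂ ∷ []) ≟ᵥ 𝟎) →-dec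
  ((λ₁ ≟ zero) ×-dec (λ₂ ≟ zero))) c₁ c₂

≢𝟎⇒nonzero-entry : ∀ {n} {v : 𝔽 n} → v ≢ 𝟎 → ∃ λ i → lookup v i ≢ zero
≢𝟎⇒nonzero-entry {v = v} v≢𝟎 with any? (λ i → ¬? (lookup v i ≟ zero))
... | yes found = found
... | no  none  = ⊥-elim (v≢𝟎 (lookup-ext λ i →
  trans (decidable-stable (lookup v i ≟ zero) (λ ne → none (i , ne))) (sym (lookup-𝟎 i))))

LinIndep₂-partner : ∀ {m} (d : 𝔽 (2 + m)) → d ≢ 𝟎 → ∃ λ e → LinIndep₂ d e
LinIndep₂-partner (d₀ ∷ d) d≢𝟎 with d₀ ≟ zero
... | yes refl = (𝟙 ∷ 𝟎) , ind
  where
  ind : LinIndep₂ (zero ∷ d) (𝟙 ∷ 𝟎)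
  ind λ₁ λ₂ eq = λ₁≡0 , λ₂≡0
    where
    pt = combine-≡𝟎⇒pointwise eq
    λ₂≡0 = unit-coefficient λ₁ λ₂ zero (pt zero) (*₃-zeroʳ λ₁)
    j,dⱼ≢0 = ≢𝟎⇒nonzero-entry λ d≡𝟎 → d≢𝟎 (cong (zero ∷_) d≡𝟎)
    j = proj₁ j,dⱼ≢0
    λ₁≡0 = nonzero-coefficient λ₁ λ₂ (proj₂ j,dⱼ≢0)
      (trans (cong (λ b → (λ₁ *₃ lookup d j) +₃ (λ₂ *₃ b)) (sym (lookup-𝟎 j))) (pt (suc j)))
... | no d₀≢0 = (zero ∷ 𝟙 ∷ 𝟎) , ind
  where
  ind : LinIndep₂ (d₀ ∷ d) (zero ∷ 𝟙 ∷ 𝟎)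
  ind λ₁ λ₂ eq =
    λ₁≡0 , unit-coefficient λ₁ λ₂ (lookup d zero) (pt (suc zero)) (cong (_*₃ lookup d zero) λ₁≡0)
    where
    pt = combine-≡𝟎⇒pointwise eq
    λ₁≡0 = nonzero-coefficient λ₁ λ₂ d₀≢0 (pt zero)

¬LinIndep₂-dim1 : ∀ a b → ¬ LinIndep₂ (a ∷ []) (b ∷ [])
¬LinIndep₂-dim1 a b ind =
  let λ₁ , λ₂ , nontrivial , eq = dependence a b in nontrivial (ind λ₁ λ₂ (cong (_∷ []) eq))
  where
  dependence : ∀ a b → ∃₂ λ λ₁ λ₂ → ¬ (λ₁ ≡ zero × λ₂ ≡ zero) × (λ₁ *₃ a) +₃ (λ₂ *₃ b) ≡ zero
  dependence = from-yes (all? λ a → all? λ b → any? λ λ₁ → any? λ λ₂ →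
    ¬? ((λ₁ ≟ zero) ×-dec (λ₂ ≟ zero)) ×-dec ((λ₁ *₃ a) +₃ (λ₂ *₃ b) ≟ zero))

length-cartesianProductWith : ∀ {A B C : Set} (f : A → B → C) xs ys →
  length (cartesianProductWith f xs ys) ≡ length xs * length ys
length-cartesianProductWith f List.[]       ys = refl
length-cartesianProductWith f (x List.∷ xs) ys =
  trans (Listₚ.length-++ (List.map (f x) ys))
        (cong₂ _+_ (Listₚ.length-map (f x) ys) (length-cartesianProductWith f xs ys))

allVecs : ∀ k → List (𝔽 k)
allVecs ℕ.zero    = List.[ [] ]
allVecs (ℕ.suc k) = cartesianProductWith _∷_ (allFin 3) (allVecs k)

∈-allVecs : ∀ {k} (v : 𝔽 k) → v ∈ allVecs k
∈-allVecs []      = here refl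
∈-allVecs (a ∷ v) = Anyₚ.cartesianProductWith⁺ _∷_ (cong₂ _∷_) (∈-allFin a) (∈-allVecs v)

allVecs-unique : ∀ k → Unique (allVecs k)
allVecs-unique ℕ.zero    = All.[] AllPairs.∷ AllPairs.[]
allVecs-unique (ℕ.suc k) =
  Uniqueₚ.cartesianProductWith⁺ _∷_ Vecₚ.∷-injective (Uniqueₚ.allFin⁺ 3) (allVecs-unique k)

length-allVecs : ∀ k → length (allVecs k) ≡ 3 ^ k
length-allVecs ℕ.zero    = refl
length-allVecs (ℕ.suc k) =
  trans (length-cartesianProductWith _∷_ (allFin 3) (allVecs k)) (cong (3 *_) (length-allVecs k))

module _ {A : Set} (_≟ₐ_ : DecidableEquality A) where
  open DecMembership _≟ₐ_ using (_∈?_)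

  unique-⊆⇒length≤ : ∀ {xs ys : List A} → Unique xs → xs ⊆ ys → length xs ≤ length ys
  unique-⊆⇒length≤ {List.[]}      _                  _  = z≤n
  unique-⊆⇒length≤ {x List.∷ xs} {ys} (x∉xs AllPairs.∷ xs!) xs⊆ys =
    ℕₚ.≤-trans (s≤s (unique-⊆⇒length≤ xs! xs⊆ys-x))
              (Listₚ.filter-notAll x≢? ys (Any.map (λ x≡y x≢y → x≢y x≡y) (xs⊆ys (here refl))))
    where
    x≢? = λ y → ¬? (x ≟ₐ y)
    xs⊆ys-x : xs ⊆ List.filter x≢? ys
    xs⊆ys-x z∈xs = ∈-filter⁺ x≢? (xs⊆ys (there z∈xs)) (All.lookup x∉xs z∈xs)

  ∃-∉-of-longer : ∀ {xs ys : List A} → Unique xs → length ys < length xs → ∃ λ x → x ∈ xs × x ∉ ys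
  ∃-∉-of-longer {xs} {ys} xs! ys<xs with Any.any? (λ x → ¬? (x ∈? ys)) xs
  ... | yes found = find found
  ... | no  none  = ⊥-elim (ℕₚ.<⇒≱ ys<xs (unique-⊆⇒length≤ xs! λ x∈xs →
    decidable-stable (_ ∈? ys) λ x∉ys → none (lose x∈xs x∉ys)))

∈⇒lookup-padRight : ∀ {A : Set} {n} {a x : A} {xs : List A} (le : length xs ≤ n) →
                    x ∈ xs → ∃ λ i → lookup (padRight le a (fromList xs)) i ≡ x
∈⇒lookup-padRight (s≤s le) (here refl) = zero , refl
∈⇒lookup-padRight (s≤s le) (there x∈xs) =
  let i , eq = ∈⇒lookup-padRight le x∈xs in suc i , eq

-- Codes generated by the columns of a matrix

encode : ∀ {k n} → Vec (𝔽 k) n → 𝔽 k → 𝔽 n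
encode G x = map (dot x) G

codewords : ∀ {k n} → Vec (𝔽 k) n → List (𝔽 n)
codewords {k} G = List.map (encode G) (allVecs k)

TrivialKernel : ∀ {k n} → Vec (𝔽 k) n → Set
TrivialKernel G = ∀ x → encode G x ≡ 𝟎 → x ≡ 𝟎

Spanning : ∀ {k n} → Vec (𝔽 k) n → Set
Spanning G = ∀ d → d ≢ 𝟎 → ∃ λ i → dot d (lookup G i) ≢ zero

Separating : ∀ {k n} → Vec (𝔽 k) n → Set
Separating G = ∀ p q → LinIndep₂ p q →
  ∃₂ λ i ζ → ζ *₃ dot p (lookup G i) ≡ 𝟙 × ζ *₃ dot q (lookup G i) ≡ 𝟚

module _ {k n} (G : Vec (𝔽 k) n) where

  lookup-encode : ∀ x i → lookup (encode G x) i ≡ dot x (lookup G i)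
  lookup-encode x i = Vecₚ.lookup-map i (dot x) G

  encode-𝟎 : encode G 𝟎 ≡ 𝟎
  encode-𝟎 = lookup-ext λ i → trans (lookup-encode 𝟎 i) (trans (dot-𝟎ˡ (lookup G i)) (sym (lookup-𝟎 i)))

  encode-⊕ : ∀ x y → encode G (x ⊕ y) ≡ encode G x ⊕ encode G y
  encode-⊕ x y = lookup-ext λ i → begin
    lookup (encode G (x ⊕ y)) i                   ≡⟨ lookup-encode (x ⊕ y) i ⟩
    dot (x ⊕ y) (lookup G i)                      ≡⟨ dot-⊕ˡ x y (lookup G i) ⟩
    dot x (lookup G i) +₃ dot y (lookup G i)      ≡⟨ cong₂ _+₃_ (lookup-encode x i) (lookup-encode y i) ⟨
    lookup (encode G x) i +₃ lookup (encode G y) i ≡⟨ Vecₚ.lookup-zipWith _+₃_ i (encode G x) (encode G y) ⟨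
    lookup (encode G x ⊕ encode G y) i            ∎
    where open ≡-Reasoning

  encode-· : ∀ ζ x → encode G (ζ · x) ≡ ζ · encode G x
  encode-· ζ x = lookup-ext λ i → begin
    lookup (encode G (ζ · x)) i   ≡⟨ lookup-encode (ζ · x) i ⟩
    dot (ζ · x) (lookup G i)      ≡⟨ dot-·ˡ ζ x (lookup G i) ⟩
    ζ *₃ dot x (lookup G i)       ≡⟨ cong (ζ *₃_) (lookup-encode x i) ⟨
    ζ *₃ lookup (encode G x) i    ≡⟨ Vecₚ.lookup-map i (ζ *₃_) (encode G x) ⟨
    lookup (ζ · encode G x) i     ∎
    where open ≡-Reasoning

  kernel⇒injective : TrivialKernel G → Injective _≡_ _≡_ (encode G)
  kernel⇒injective ker {x} {y} eq = ⊖-≡𝟎⇒≡ (ker (x ⊖ y) (begin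
    encode G (x ⊖ y)          ≡⟨ encode-⊕ x (𝟚 · y) ⟩
    encode G x ⊕ encode G (𝟚 · y) ≡⟨ cong₂ _⊕_ eq (encode-· 𝟚 y) ⟩
    encode G y ⊖ encode G y   ≡⟨ ⊖-self (encode G y) ⟩
    𝟎                         ∎))
    where open ≡-Reasoning

  spanning⇒kernel : Spanning G → TrivialKernel G
  spanning⇒kernel span d eq with d ≟ᵥ 𝟎
  ... | yes d≡𝟎 = d≡𝟎
  ... | no  d≢𝟎 = let i , dᵢ≢0 = span d d≢𝟎 in
    ⊥-elim (dᵢ≢0 (trans (sym (lookup-encode d i)) (trans (cong (λ w → lookup w i) eq) (lookup-𝟎 i))))

  ∈-codewords : ∀ x → encode G x ∈ codewords G
  ∈-codewords x = ∈-map⁺ (encode G) (∈-allVecs x)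

  codewords-linear : IsLinear (codewords G)
  codewords-linear = subst (_∈ codewords G) encode-𝟎 (∈-codewords 𝟎) , closed-⊕ , closed-·
    where
    closed-⊕ : ∀ {u v} → u ∈ codewords G → v ∈ codewords G → (u ⊕ v) ∈ codewords G
    closed-⊕ u∈ v∈ with ∈-map⁻ (encode G) u∈ | ∈-map⁻ (encode G) v∈
    ... | x , _ , refl | y , _ , refl = subst (_∈ codewords G) (encode-⊕ x y) (∈-codewords (x ⊕ y))
    closed-· : ∀ ζ {u} → u ∈ codewords G → (ζ · u) ∈ codewords G
    closed-· ζ u∈ with ∈-map⁻ (encode G) u∈
    ... | x , _ , refl = subst (_∈ codewords G) (encode-· ζ x) (∈-codewords (ζ · x))

  codewords-unique : TrivialKernel G → Unique (codewords G)
  codewords-unique ker = Uniqueₚ.map⁺ (kernel⇒injective ker) (allVecs-unique k)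

  length-codewords : length (codewords G) ≡ 3 ^ k
  length-codewords = trans (Listₚ.length-map (encode G) (allVecs k)) (length-allVecs k)

  separating⇒covers : Spanning G → Separating G → ∀ {p q} → p ≢ 𝟎 → q ≢ 𝟎 → p ≢ q →
                      ∃ λ i → Covers zero (dot p (lookup G i)) (dot q (lookup G i))
  separating⇒covers span sep {p} p≢𝟎 q≢𝟎 p≢q with distinct⇒LinIndep₂⊎double p≢𝟎 q≢𝟎 p≢q
  ... | inj₁ ind  = let i , ζ , e₁ , e₂ = sep p _ ind in i , scaled-𝟙𝟚⇒covers ζ e₁ e₂
  ... | inj₂ refl = let i , pᵢ≢0 = span p p≢𝟎 in
    i , covers-cong refl refl (sym (dot-·ˡ 𝟚 p (lookup G i))) (covers-double pᵢ≢0)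

  codewords-trifferent : Spanning G → Separating G → IsTrifferent (codewords G)
  codewords-trifferent span sep x∈ y∈ z∈ x≢y y≢z x≢z
    with ∈-map⁻ (encode G) x∈ | ∈-map⁻ (encode G) y∈ | ∈-map⁻ (encode G) z∈
  ... | x , _ , refl | y , _ , refl | z , _ , refl =
    let i , covers = separating⇒covers span sep
                       (λ eq → x≢y (cong (encode G) (sym (⊖-≡𝟎⇒≡ eq))))
                       (λ eq → x≢z (cong (encode G) (sym (⊖-≡𝟎⇒≡ eq))))
                       (λ eq → y≢z (cong (encode G) (⊖-cancelʳ eq)))
        g = lookup G i
    in i , covers-cong (sym (lookup-encode x i)) (sym (lookup-encode y i)) (sym (lookup-encode z i))
             (covers-translate (covers-cong refl (dot-⊖ˡ y x g) (dot-⊖ˡ z x g) covers))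

  generated-code : Spanning G → Separating G → T_L-≥ n (3 ^ k)
  generated-code span sep = codewords G , codewords-unique (spanning⇒kernel span) , codewords-linear
                          , codewords-trifferent span sep , ℕₚ.≤-reflexive (sym length-codewords)

-- From blocking sets to codes

blocking⇒separating : ∀ {k n} {G : Vec (𝔽 k) n} {B} → (∀ {b} → b ∈ B → ∃ λ i → lookup G i ≡ b) →
                      Is2Blocking (Scaled B) → Separating G
blocking⇒separating B⊆G blocking p q ind with blocking p q 𝟙 𝟚 ind
... | _ , (ζ , b , b∈B , refl) , e₁ , e₂ with B⊆G b∈B
... | i , refl = i , ζ , trans (sym (dot-·ʳ ζ p _)) e₁ , trans (sym (dot-·ʳ ζ q _)) e₂

separating⇒spanning : ∀ {m n} {G : Vec (𝔽 (2 + m)) n} → Separating G → Spanning G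
separating⇒spanning sep d d≢𝟎 =
  let e , ind = LinIndep₂-partner d d≢𝟎
      i , ζ , ζdᵢ≡𝟙 , _ = sep d e ind
  in i , λ dᵢ≡0 → 𝟙≢zero (trans (sym ζdᵢ≡𝟙) (trans (cong (ζ *₃_) dᵢ≡0) (*₃-zeroʳ ζ)))
  where
  𝟙≢zero : 𝟙 ≢ zero
  𝟙≢zero ()

repetition-code : ∀ n → T_L-≥ (ℕ.suc n) (3 ^ 1)
repetition-code n =
  generated-code G spanning (λ { (a ∷ []) (b ∷ []) ind → ⊥-elim (¬LinIndep₂-dim1 a b ind) })
  where
  G = replicate (ℕ.suc n) (𝟙 ∷ [])
  spanning : Spanning G
  spanning (a ∷ []) a≢𝟎 = zero , λ eq →
    a≢𝟎 (cong (_∷ []) (trans (sym (*₃-identityʳ a)) (trans (sym (+₃-identityʳ (a *₃ 𝟙))) eq)))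

b'₃⇒T_L : ∀ {k n} → 1 ≤ k → 1 ≤ n → b'₃-≤ k n → T_L-≥ n (3 ^ k)
b'₃⇒T_L {1}               {ℕ.suc n} _ _ _ = repetition-code n
b'₃⇒T_L {ℕ.suc (ℕ.suc m)} {n}       _ _ (B , _ , blocking , |B|≤n) =
  generated-code G (separating⇒spanning {G = G} separating) separating
  where
  G : Vec (𝔽 (2 + m)) n
  G = padRight |B|≤n 𝟎 (fromList B)
  separating : Separating G
  separating = blocking⇒separating {G = G} (∈⇒lookup-padRight |B|≤n) blocking

-- From codes to blocking sets

extend : ∀ {j n} → 𝔽 n → Vec (𝔽 j) n → Vec (𝔽 (ℕ.suc j)) n
extend = zipWith _∷_

encode-extend : ∀ {j n} (c : 𝔽 n) (G : Vec (𝔽 j) n) a x →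
                encode (extend c G) (a ∷ x) ≡ (a · c) ⊕ encode G x
encode-extend []      []      a x = refl
encode-extend (c ∷ cs) (g ∷ G) a x = cong (((a *₃ c) +₃ dot x g) ∷_) (encode-extend cs G a x)

extend-kernel : ∀ {j n} {c : 𝔽 n} {G : Vec (𝔽 j) n} → TrivialKernel G → (∀ x → c ≢ encode G x) →
                TrivialKernel (extend c G)
extend-kernel {c = c} {G} ker c∉G (a ∷ x) eq with a ≟ zero
... | yes refl = cong (zero ∷_)
  (ker x (trans (sym (zero·-⊕ c (encode G x))) (trans (sym (encode-extend c G zero x)) eq)))
... | no  a≢0  = ⊥-elim (c∉G ((-₃ a) · x)
  (trans (·-⊕-solve a≢0 (trans (sym (encode-extend c G a x)) eq)) (sym (encode-· G (-₃ a) x))))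

SubcodeGenerator : ∀ {n} → List (𝔽 n) → ℕ → Set
SubcodeGenerator {n} C j = Σ (Vec (𝔽 j) n) λ G → TrivialKernel G × (∀ x → encode G x ∈ C)

linear-code⇒subcode-generator : ∀ {n} {C : List (𝔽 n)} → Unique C → IsLinear C →
                                ∀ j → 3 ^ j ≤ length C → SubcodeGenerator C j
linear-code⇒subcode-generator {n} {C} _ (𝟎∈C , _) ℕ.zero _ =
  replicate n [] , (λ { [] _ → refl }) , λ { [] → subst (_∈ C) (sym (encode-𝟎 (replicate n []))) 𝟎∈C }
linear-code⇒subcode-generator {C = C} C! lin@(_ , closed-⊕ , closed-·) (ℕ.suc j) size =
  let G , ker , G∈C = linear-code⇒subcode-generator C! lin j (ℕₚ.<⇒≤ 3ʲ<|C|)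
      c , c∈C , c∉G = ∃-∉-of-longer _≟ᵥ_ C! (subst (_< length C) (sym (length-codewords G)) 3ʲ<|C|)
  in extend c G
   , extend-kernel ker (λ x c≡ → c∉G (subst (_∈ codewords G) (sym c≡) (∈-codewords G x)))
   , λ { (a ∷ x) → subst (_∈ C) (sym (encode-extend c G a x)) (closed-⊕ (closed-· a c∈C) (G∈C x)) }
  where
  3ʲ<|C| : 3 ^ j < length C
  3ʲ<|C| = ℕₚ.<-≤-trans (ℕₚ.^-monoʳ-< 3 (s≤s (s≤s z≤n)) (ℕₚ.n<1+n j)) size

trifferent⇒separating : ∀ {k n} {C : List (𝔽 n)} {G : Vec (𝔽 k) n} →
                        TrivialKernel G → (∀ x → encode G x ∈ C) → IsTrifferent C → Separating G
trifferent⇒separating {G = G} ker G∈C triff p q ind =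
  let p≢𝟎 , q≢𝟎 , p≢q = LinIndep₂⇒distinct ind
      i , covers = triff (G∈C 𝟎) (G∈C p) (G∈C q)
                     (λ eq → p≢𝟎 (sym (injective eq))) (λ eq → p≢q (injective eq))
                     (λ eq → q≢𝟎 (sym (injective eq)))
  in i , covers⇒scaled-𝟙𝟚 (covers-cong (encode-𝟎-entry i) (lookup-encode G p i) (lookup-encode G q i)
                                       covers)
  where
  injective = kernel⇒injective G ker
  encode-𝟎-entry : ∀ i → lookup (encode G 𝟎) i ≡ zero
  encode-𝟎-entry i = trans (cong (λ w → lookup w i) (encode-𝟎 G)) (lookup-𝟎 i)

separating⇒blocking : ∀ {k n} {G : Vec (𝔽 k) n} {B} → Fin n → (∀ i → lookup G i ∈ B) →
                      Separating G → Is2Blocking (Scaled B)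
separating⇒blocking {G = G} i₀ G⊆B sep a₁ a₂ c₁ c₂ ind with (c₁ ∷ c₂ ∷ []) ≟ᵥ 𝟎
... | yes refl = zero · g₀ , (zero , g₀ , G⊆B i₀ , refl) , dot-·ʳ zero a₁ g₀ , dot-·ʳ zero a₂ g₀
  where g₀ = lookup G i₀
... | no  c≢𝟎 =
  let i , ζ , e₁ , e₂ = sep p q (LinIndep₂-combine ind (companion-LinIndep₂ c≢𝟎))
      g = lookup G i
      ζ′ , ζ′X≡c₁ , ζ′Y≡c₂ = companion-pullback ζ
                               (trans (cong (ζ *₃_) (sym (dot-combine c₁ c₂ a₁ a₂ g))) e₁)
                               (trans (cong (ζ *₃_) (sym (dot-combine d₁ d₂ a₁ a₂ g))) e₂)
  in ζ′ · g , (ζ′ , g , G⊆B i , refl) , trans (dot-·ʳ ζ′ a₁ g) ζ′X≡c₁ , trans (dot-·ʳ ζ′ a₂ g) ζ′Y≡c₂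
  where
  d₁ = companion₁ c₁ c₂
  d₂ = companion₂ c₁ c₂
  p = combine c₁ c₂ a₁ a₂
  q = combine d₁ d₂ a₁ a₂

trifferent-subcode⇒blocking-set : ∀ {k n} {C : List (𝔽 n)} → Fin n → IsTrifferent C →
                                  SubcodeGenerator C k → b'₃-≤ k n
trifferent-subcode⇒blocking-set i₀ triff (G , ker , G∈C) =
  B , UniqueDecₚ.deduplicate-! _≟ᵥ_ columns
    , separating⇒blocking {G = G} i₀ (λ i → ∈-deduplicate⁺ _≟ᵥ_ (∈-tabulate⁺ {f = lookup G} i))
                          (trifferent⇒separating ker G∈C triff)
    , ℕₚ.≤-trans (Listₚ.length-deduplicate _≟ᵥ_ columns)
                 (ℕₚ.≤-reflexive (Listₚ.length-tabulate (lookup G)))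
  where
  columns = tabulate (lookup G)
  B = deduplicate _≟ᵥ_ columns

T_L⇒b'₃ : ∀ {k n} → 1 ≤ n → T_L-≥ n (3 ^ k) → b'₃-≤ k n
T_L⇒b'₃ {k} {ℕ.suc n} _ (C , C! , lin , triff , size) =
  trifferent-subcode⇒blocking-set zero triff (linear-code⇒subcode-generator C! lin k size)

corollary6p3 : (k n : ℕ) → 1 ≤ k → 1 ≤ n → (T_L-≥ n (3 ^ k) ⇔ b'₃-≤ k n)
corollary6p3 k n k≥1 n≥1 = mk⇔ (T_L⇒b'₃ n≥1) (b'₃⇒T_L k≥1 n≥1)
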